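{- If all the lists of vertices have size at least $4$, then a left-to-right path is online nonrepetitively list-colorable. -}

module Defs where

open import Data.Nat using (ℕ; zero; suc; _+_; _≤_; _<_)
open import Data.List using (List; length)
open import Data.List.Relation.Unary.Unique.Propositional using (Unique)
open import Data.List.Membership.Propositional using (_∈_)
open import Data.Vec using (Vec; tabulate)
open import Data.Fin using (Fin; toℕ)
open import Data.Product using (Σ; _×_; proj₁; ∃)
open import Relation.Nullary using (¬_)
open import Relation.Binary.PropositionalEquality using (_≡_)

ValidList : ℕ → List ℕ → Set
ValidList k L = Unique L × k ≤ length L

-- A colouring of the (one-way infinite) path v₀ v₁ v₂ … is a map ℕ → ℕ.
Nonrepetitive : (ℕ → ℕ) → Set
Nonrepetitive c =
  (i k : ℕ) → 1 ≤ k → ¬ ((j : ℕ) → j < k → c (i + j) ≡ c (i + k + j))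

-- Online game on the left-to-right path with lists of size ≥ k:
-- the vertices are revealed from left to right; when vertex n is revealed
-- together with its list, Painter must immediately choose a colour from it,
-- knowing only the lists revealed so far (and hence, Painter being
-- deterministic, all colours chosen so far).
Strategy : ℕ → Set
Strategy k = ∀ {n} → (past : Vec (List ℕ) n) → (L : List ℕ) → ValidList k L → Σ ℕ (_∈ L)

play : ∀ {k} → Strategy k → (lists : ℕ → List ℕ) → ((i : ℕ) → ValidList k (lists i)) → ℕ → ℕ
play s lists valid n = proj₁ (s (tabulate (λ (i : Fin n) → lists (toℕ i))) (lists n) (valid n))

OnlineNonrepListColorable : ℕ → Set
OnlineNonrepListColorable k =
  Σ (Strategy k) λ s → (lists : ℕ → List ℕ) → (valid : (i : ℕ) → ValidList k (lists i)) →
    Nonrepetitive (play s lists valid)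

-- Painter keeps a pending item for every block whose second half has so far copied its
-- first half, weighted 2^(i+2t) for a block starting at i with t matched positions, and
-- picks the colour of its list that extends the least pending weight. An item is extended
-- by at most one colour, so among four distinct colours one extends at most a quarter of
-- the pending weight. Extended items gain a factor 4 and the blocks opened at time m add
-- 2^(m+1) - 1, hence the pending weight at time m stays below 2^(m+1). Completing a square
-- of half-length k+1 at time m = i+2k+1 would extend an item of weight 2^(i+2k) = 2^(m-1),
-- a full quarter of 2^(m+1).
module Submission where

open import Defs
open import Data.Fin using (Fin; toℕ)
open import Data.List using (List; []; _∷_; [_]; _++_; length; map; filter; applyDownFrom)
open import Data.List.Extrema.Nat using (argmin; argmin-sel; f[argmin]≤f[⊤]; f[argmin]≤f[xs])
open import Data.List.Membership.Propositional using (_∈_)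
open import Data.List.Membership.Propositional.Properties
  using (∈-++⁺ˡ; ∈-++⁺ʳ; ∈-map⁺; ∈-filter⁺; ∈-applyDownFrom⁺)
open import Data.List.Properties using (map-++; map-cong; filter-++; filter-accept; filter-reject)
open import Data.List.Relation.Unary.All using (All; []; _∷_)
open import Data.List.Relation.Unary.AllPairs using ([]; _∷_)
open import Data.List.Relation.Unary.Any using (here; there)
open import Data.List.Relation.Unary.Unique.Propositional using (Unique)
open import Data.Nat using (ℕ; zero; suc; _+_; _*_; _^_; _∸_; _≤_; _<_; z≤n; s≤s; _≟_)
open import Data.Nat.ListAction using (sum)
open import Data.Nat.ListAction.Properties using (sum-++)
open import Data.Nat.Properties
open import Algebra.Properties.CommutativeSemigroup +-commutativeSemigroup using (interchange)
open import Data.Product using (_×_; _,_)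
open import Data.Sum using (inj₁; inj₂)
open import Data.Vec using (Vec; []; _∷_; tabulate)
open import Function using (_∘_)
open import Relation.Nullary using (Dec; yes; no)
open import Relation.Binary.PropositionalEquality
  using (_≡_; _≢_; refl; sym; trans; cong; cong₂; subst; subst₂; module ≡-Reasoning)

module _ {A : Set} (f : A → ℕ) where

  sum-map-+ : ∀ (g : A → ℕ) xs →
              sum (map (λ x → f x + g x) xs) ≡ sum (map f xs) + sum (map g xs)
  sum-map-+ g [] = refl
  sum-map-+ g (x ∷ xs) =
    trans (cong (f x + g x +_) (sum-map-+ g xs)) (interchange (f x) (g x) _ _)

  ∈⇒≤sum-map : ∀ {x xs} → x ∈ xs → f x ≤ sum (map f xs)
  ∈⇒≤sum-map (here refl) = m≤m+n _ _
  ∈⇒≤sum-map {xs = y ∷ _} (there x∈xs) = ≤-trans (∈⇒≤sum-map x∈xs) (m≤n+m _ (f y))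

  length*≤sum-map : ∀ {m} xs → All (λ x → m ≤ f x) xs → length xs * m ≤ sum (map f xs)
  length*≤sum-map [] [] = z≤n
  length*≤sum-map (x ∷ xs) (m≤fx ∷ m≤fxs) = +-mono-≤ m≤fx (length*≤sum-map xs m≤fxs)

  argmin∈ : ∀ x xs → argmin f x xs ∈ x ∷ xs
  argmin∈ x xs with argmin-sel f x xs
  ... | inj₁ argmin≡x = here argmin≡x
  ... | inj₂ argmin∈xs = there argmin∈xs

  length*argmin≤sum : ∀ x xs → length (x ∷ xs) * f (argmin f x xs) ≤ sum (map f (x ∷ xs))
  length*argmin≤sum x xs =
    length*≤sum-map (x ∷ xs) (f[argmin]≤f[⊤] {f = f} x xs ∷ f[argmin]≤f[xs] {f = f} x xs)

module _ {A : Set} (weight : A → ℕ) (key : A → ℕ) where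

  massAt : ℕ → List A → ℕ
  massAt c xs = sum (map weight (filter (λ x → key x ≟ c) xs))

  massAt-++ : ∀ c xs ys → massAt c (xs ++ ys) ≡ massAt c xs + massAt c ys
  massAt-++ c xs ys = begin
    sum (map weight (filter P? (xs ++ ys)))
      ≡⟨ cong (sum ∘ map weight) (filter-++ P? xs ys) ⟩
    sum (map weight (filter P? xs ++ filter P? ys))
      ≡⟨ cong sum (map-++ weight (filter P? xs) _) ⟩
    sum (map weight (filter P? xs) ++ map weight (filter P? ys))
      ≡⟨ sum-++ (map weight (filter P? xs)) _ ⟩
    massAt c xs + massAt c ys ∎
    where
    open ≡-Reasoning
    P? : (x : A) → Dec (key x ≡ c)
    P? x = key x ≟ c

  massAt-[_]-accept : ∀ x {c} → key x ≡ c → massAt c [ x ] ≡ weight x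
  massAt-[ x ]-accept x≡c =
    trans (cong (sum ∘ map weight) (filter-accept (λ y → key y ≟ _) x≡c))
          (+-identityʳ (weight x))

  massAt-[_]-reject : ∀ x {c} → key x ≢ c → massAt c [ x ] ≡ 0
  massAt-[ x ]-reject x≢c = cong (sum ∘ map weight) (filter-reject (λ y → key y ≟ _) x≢c)

  sum-massAt-≢ : ∀ x {cs} → All (key x ≢_) cs → sum (map (λ c → massAt c [ x ]) cs) ≡ 0
  sum-massAt-≢ x [] = refl
  sum-massAt-≢ x (x≢c ∷ x≢cs) = cong₂ _+_ (massAt-[ x ]-reject x≢c) (sum-massAt-≢ x x≢cs)

  sum-massAt-[_]≤ : ∀ x {cs} → Unique cs → sum (map (λ c → massAt c [ x ]) cs) ≤ weight x
  sum-massAt-[ x ]≤ [] = z≤n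
  sum-massAt-[ x ]≤ {c ∷ cs} (c∉cs ∷ cs-unique) with key x ≟ c
  ... | yes refl = ≤-reflexive
    (trans (cong₂ _+_ (massAt-[ x ]-accept refl) (sum-massAt-≢ x c∉cs)) (+-identityʳ (weight x)))
  ... | no x≢c = ≤-trans (≤-reflexive (cong (_+ _) (massAt-[ x ]-reject x≢c)))
                         (sum-massAt-[ x ]≤ cs-unique)

  -- Each element is counted at most once because its key equals at most one element of cs.
  sum-massAt≤sum : ∀ {cs} → Unique cs → ∀ xs →
                   sum (map (λ c → massAt c xs) cs) ≤ sum (map weight xs)
  sum-massAt≤sum {cs} _ [] = ≤-reflexive (sum-zero cs)
    where
    sum-zero : ∀ cs → sum (map (λ _ → 0) cs) ≡ 0
    sum-zero [] = refl
    sum-zero (_ ∷ cs) = sum-zero cs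
  sum-massAt≤sum {cs} cs-unique (x ∷ xs) = begin
    sum (map (λ c → massAt c ([ x ] ++ xs)) cs)
      ≡⟨ cong sum (map-cong (λ c → massAt-++ c [ x ] xs) cs) ⟩
    sum (map (λ c → massAt c [ x ] + massAt c xs) cs)
      ≡⟨ sum-map-+ (λ c → massAt c [ x ]) (λ c → massAt c xs) cs ⟩
    sum (map (λ c → massAt c [ x ]) cs) + sum (map (λ c → massAt c xs) cs)
      ≤⟨ +-mono-≤ (sum-massAt-[ x ]≤ cs-unique) (sum-massAt≤sum cs-unique xs) ⟩
    weight x + sum (map weight xs) ∎
    where open ≤-Reasoning

-- (k , e): a block of half-length k+1 starting at i with t positions matched, e = i+2t;
-- its next vertex must repeat entry k of the reversed colour history.
Item : Set
Item = ℕ × ℕ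

weight : Item → ℕ
weight (_ , e) = 2 ^ e

potential : List Item → ℕ
potential = sum ∘ map weight

bump : Item → Item
bump (k , e) = k , 2 + e

2^n+2^n≡2^[1+n] : ∀ n → 2 ^ n + 2 ^ n ≡ 2 ^ suc n
2^n+2^n≡2^[1+n] n = cong (2 ^ n +_) (sym (+-identityʳ (2 ^ n)))

weight-bump : ∀ item → weight (bump item) ≡ 4 * weight item
weight-bump (_ , e) = sym (*-assoc 2 2 (2 ^ e))

potential-++ : ∀ xs ys → potential (xs ++ ys) ≡ potential xs + potential ys
potential-++ xs ys = trans (cong sum (map-++ weight xs ys)) (sum-++ (map weight xs) _)

potential-map-bump : ∀ xs → potential (map bump xs) ≡ 4 * potential xs
potential-map-bump [] = refl
potential-map-bump (x ∷ xs) =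
  trans (cong₂ _+_ (weight-bump x) (potential-map-bump xs)) (sym (*-distribˡ-+ 4 (weight x) _))

suc-potential-applyDownFrom : ∀ (g : ℕ → ℕ) n →
                              suc (potential (applyDownFrom (λ e → g e , e) n)) ≡ 2 ^ n
suc-potential-applyDownFrom g zero = refl
suc-potential-applyDownFrom g (suc n) = begin
  suc (2 ^ n + potential (applyDownFrom (λ e → g e , e) n))
    ≡⟨ sym (+-suc (2 ^ n) _) ⟩
  2 ^ n + suc (potential (applyDownFrom (λ e → g e , e) n))
    ≡⟨ cong (2 ^ n +_) (suc-potential-applyDownFrom g n) ⟩
  2 ^ n + 2 ^ n
    ≡⟨ 2^n+2^n≡2^[1+n] n ⟩
  2 ^ suc n ∎
  where open ≡-Reasoning

nth : List ℕ → ℕ → ℕ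
nth [] _ = 0
nth (x ∷ _) zero = x
nth (_ ∷ xs) (suc k) = nth xs k

nth-applyDownFrom : ∀ (g : ℕ → ℕ) k d → nth (applyDownFrom g (suc (k + d))) k ≡ g d
nth-applyDownFrom g zero d = refl
nth-applyDownFrom g (suc k) d = nth-applyDownFrom g k d

record State : Set where
  constructor ⟨_,_⟩
  field
    history : List ℕ
    pending : List Item

open State

demandedColour : State → Item → ℕ
demandedColour s (k , _) = nth (history s) k

extendedBy : State → ℕ → List Item
extendedBy s c = filter (λ item → demandedColour s item ≟ c) (pending s)

cost : State → ℕ → ℕ
cost s c = potential (extendedBy s c)

colourFor : State → List ℕ → ℕ
colourFor s [] = 0
colourFor s (c ∷ cs) = argmin (cost s) c cs

freshItems : ℕ → List Item
freshItems m = applyDownFrom (λ e → m ∸ e , e) (suc m)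

step : ℕ → State → List ℕ → State
step m s L = let c = colourFor s L in ⟨ c ∷ history s , freshItems m ++ map bump (extendedBy s c) ⟩

state : (ℕ → List ℕ) → ℕ → State
state f zero = ⟨ [] , [] ⟩
state f (suc m) = step m (state f m) (f m)

colouring : (ℕ → List ℕ) → ℕ → ℕ
colouring f m = colourFor (state f m) (f m)

∈-extendedBy : ∀ s {item c} → item ∈ pending s →
                demandedColour s item ≡ c → item ∈ extendedBy s c
∈-extendedBy s {c = c} = ∈-filter⁺ (λ item → demandedColour s item ≟ c)

cost-colourFor : ∀ {k} s L → ValidList k L → k * cost s (colourFor s L) ≤ potential (pending s)
cost-colourFor s [] (_ , z≤n) = z≤n
cost-colourFor {k} s (c ∷ cs) (cs-unique , k≤length) = begin
  k * cost s (argmin (cost s) c cs)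
    ≤⟨ *-monoˡ-≤ _ k≤length ⟩
  length (c ∷ cs) * cost s (argmin (cost s) c cs)
    ≤⟨ length*argmin≤sum (cost s) c cs ⟩
  sum (map (cost s) (c ∷ cs))
    ≤⟨ sum-massAt≤sum weight (demandedColour s) cs-unique (pending s) ⟩
  potential (pending s) ∎
  where open ≤-Reasoning

colourFor∈ : ∀ {k} s L → ValidList (suc k) L → colourFor s L ∈ L
colourFor∈ s (c ∷ cs) _ = argmin∈ (cost s) c cs

module Painting (f : ℕ → List ℕ) (valid : ∀ i → ValidList 4 (f i)) where

  potential-pending< : ∀ m → potential (pending (state f m)) < 2 ^ suc m
  potential-pending< zero = s≤s z≤n
  potential-pending< (suc m) = begin-strict
    potential (freshItems m ++ map bump (extendedBy s c))
      ≡⟨ potential-++ (freshItems m) _ ⟩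
    potential (freshItems m) + potential (map bump (extendedBy s c))
      ≡⟨ cong (potential (freshItems m) +_) (potential-map-bump (extendedBy s c)) ⟩
    potential (freshItems m) + 4 * cost s c
      <⟨ +-mono-<-≤ (≤-reflexive (suc-potential-applyDownFrom (m ∸_) (suc m)))
                    (<⇒≤ (≤-<-trans (cost-colourFor s (f m) (valid m)) (potential-pending< m))) ⟩
    2 ^ suc m + 2 ^ suc m
      ≡⟨ 2^n+2^n≡2^[1+n] (suc m) ⟩
    2 ^ suc (suc m) ∎
    where
    open ≤-Reasoning
    s : State
    s = state f m
    c : ℕ
    c = colouring f m

  weight-bump-extended< : ∀ m {item} → item ∈ extendedBy (state f m) (colouring f m) →
                          weight (bump item) < 2 ^ suc m
  weight-bump-extended< m {item} item∈extended = begin-strict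
    weight (bump item)                   ≡⟨ weight-bump item ⟩
    4 * weight item                      ≤⟨ *-monoʳ-≤ 4 (∈⇒≤sum-map weight item∈extended) ⟩
    4 * cost (state f m) (colouring f m) ≤⟨ cost-colourFor (state f m) (f m) (valid m) ⟩
    potential (pending (state f m))      <⟨ potential-pending< m ⟩
    2 ^ suc m                            ∎
    where open ≤-Reasoning

  history-state : ∀ m → history (state f m) ≡ applyDownFrom (colouring f) m
  history-state zero = refl
  history-state (suc m) = cong (colouring f m ∷_) (history-state m)

  demandedColour-state : ∀ k d e → demandedColour (state f (suc k + d)) (k , e) ≡ colouring f d
  demandedColour-state k d e =
    trans (cong (λ h → nth h k) (history-state (suc k + d))) (nth-applyDownFrom (colouring f) k d)

  fresh∈pending : ∀ k e → (k , e) ∈ pending (state f (suc (k + e)))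
  fresh∈pending k e = ∈-++⁺ˡ (subst (λ j → (j , e) ∈ freshItems (k + e)) (m+n∸n≡m k e)
    (∈-applyDownFrom⁺ (λ e′ → k + e ∸ e′ , e′) (s≤s (m≤n+m e k))))

  extended∈pending : ∀ m {k e} → (k , e) ∈ pending (state f m) →
                     demandedColour (state f m) (k , e) ≡ colouring f m →
                     (k , 2 + e) ∈ pending (state f (suc m))
  extended∈pending m item∈pending demanded =
    ∈-++⁺ʳ (freshItems m) (∈-map⁺ bump (∈-extendedBy (state f m) item∈pending demanded))

  pending-tracks : ∀ i k t →
                   (∀ j → j < t → colouring f (j + i) ≡ colouring f (suc k + (j + i))) →
                   (k , t * 2 + i) ∈ pending (state f (suc k + (t + i)))
  pending-tracks i k zero _ = fresh∈pending k i
  pending-tracks i k (suc t) agree =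
    subst (λ m → (k , suc t * 2 + i) ∈ pending (state f m)) (cong suc (sym (+-suc k (t + i))))
      (extended∈pending (suc k + (t + i))
        (pending-tracks i k t (λ j j<t → agree j (m≤n⇒m≤1+n j<t)))
        (trans (demandedColour-state k (t + i) (t * 2 + i)) (agree t ≤-refl)))

  colouring-nonrepetitive : Nonrepetitive (colouring f)
  colouring-nonrepetitive i zero () _
  colouring-nonrepetitive i (suc k) _ square =
    <-irrefl (cong (λ e → 2 ^ (2 + e)) exponent≡)
             (weight-bump-extended< (suc k + (k + i)) completed)
    where
    shift : ∀ j → i + suc k + j ≡ suc k + (j + i)
    shift j = begin
      i + suc k + j   ≡⟨ cong (_+ j) (+-comm i (suc k)) ⟩
      suc k + i + j   ≡⟨ +-assoc (suc k) i j ⟩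
      suc k + (i + j) ≡⟨ cong (suc k +_) (+-comm i j) ⟩
      suc k + (j + i) ∎
      where open ≡-Reasoning
    agree : ∀ j → j < suc k → colouring f (j + i) ≡ colouring f (suc k + (j + i))
    agree j j<1+k =
      subst₂ (λ p q → colouring f p ≡ colouring f q) (+-comm i j) (shift j) (square j j<1+k)
    completed :
      (k , k * 2 + i) ∈ extendedBy (state f (suc k + (k + i))) (colouring f (suc k + (k + i)))
    completed = ∈-extendedBy (state f (suc k + (k + i)))
                  (pending-tracks i k k (λ j j<k → agree j (m≤n⇒m≤1+n j<k)))
                  (trans (demandedColour-state k (k + i) (k * 2 + i)) (agree k ≤-refl))
    exponent≡ : k * 2 + i ≡ k + (k + i)
    exponent≡ = begin
      k * 2 + i       ≡⟨ cong (_+ i) (*-comm k 2) ⟩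
      k + (k + 0) + i ≡⟨ cong (λ x → k + x + i) (+-identityʳ k) ⟩
      k + k + i       ≡⟨ +-assoc k k i ⟩
      k + (k + i)     ∎
      where open ≡-Reasoning

lookupOr : ∀ {A : Set} {n} → A → Vec A n → ℕ → A
lookupOr d [] _ = d
lookupOr d (x ∷ _) zero = x
lookupOr d (_ ∷ xs) (suc i) = lookupOr d xs i

lookupOr-tabulate : ∀ {A : Set} {d : A} n (g : ℕ → A) {i} → i < n →
                    lookupOr d (tabulate (λ (j : Fin n) → g (toℕ j))) i ≡ g i
lookupOr-tabulate (suc n) g {zero} _ = refl
lookupOr-tabulate (suc n) g {suc i} (s≤s i<n) = lookupOr-tabulate n (g ∘ suc) i<n

state-cong : ∀ {f g} n → (∀ {i} → i < n → f i ≡ g i) → state f n ≡ state g n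
state-cong zero _ = refl
state-cong (suc n) f≡g = cong₂ (step n) (state-cong n (f≡g ∘ m≤n⇒m≤1+n)) (f≡g ≤-refl)

painter : Strategy 4
painter {n} past L valid = colourFor (state (lookupOr [] past) n) L , colourFor∈ _ L valid

play-painter : ∀ lists valid n → play painter lists valid n ≡ colouring lists n
play-painter lists valid n =
  cong (λ s → colourFor s (lists n)) (state-cong n (lookupOr-tabulate n lists))

Nonrepetitive-resp : ∀ {c c′ : ℕ → ℕ} → (∀ n → c n ≡ c′ n) → Nonrepetitive c → Nonrepetitive c′
Nonrepetitive-resp c≡c′ c-nonrep i k k≥1 square = c-nonrep i k k≥1 λ j j<k →
  trans (c≡c′ (i + j)) (trans (square j j<k) (sym (c≡c′ (i + k + j))))

corollary7 : OnlineNonrepListColorable 4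
corollary7 = painter , λ lists valid →
  Nonrepetitive-resp (sym ∘ play-painter lists valid) (Painting.colouring-nonrepetitive lists valid)
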